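{- Let $\mathcal{E}$ be an existential PBES in normal form (as in the context). Suppose that the sequence $\mathcal{P}_0, H(\mathcal{P}_0), H(H(\mathcal{P}_0)),\dots$ reaches a fixed point, i.e. there is $m$ with $H^{m+1}(\mathcal{P}_0)=H^m(\mathcal{P}_0)$, and let $\mathcal{P}=H^m(\mathcal{P}_0)$. Then the pair $\langle\sim^D_{\mathcal{P}},\sim^B_{\mathcal{P}}\rangle$ is feasible.
   Context: Normal-form existential PBES: equations $\sigma_i X_i(\vec d)=\bigvee_{1\le k\le m_i}\exists\vec e\,\big(\varphi_{ik}(\vec d,\vec e)\wedge X_{a_{ik1}}(\vec f_{ik1}(\vec d,\vec e))\wedge\cdots\wedge X_{a_{ikp_{ik}}}(\vec f_{ikp_{ik}}(\vec d,\vec e))\big)$ for $i=1,\dots,n$, $\sigma_i\in\{\mu,\nu\}$, where the parameters of $X_i$ range over a domain $\mathbb{D}_i$, $\vec e$ ranges over $\mathbb{E}_{ik}$, $\varphi_{ik}$ is a Boolean data expression with free variables among $\vec d,\vec e$, and $\vec f_{ikj}$ are data expressions. Let $\mathrm{sig}(\mathcal{E})=\{X_i(\vec v)\mid 1\le i\le n,\vec v\in\mathbb{D}_i\}$ and $B=\{(i,k,\vec v,\vec w)\mid 1\le i\le n,1\le k\le m_i,\vec v\in\mathbb{D}_i,\vec w\in\mathbb{E}_{ik}\}$. Define $F_{ik}(X_j(\vec v))=\{(i,k,\vec v,\vec w)\mid\varphi_{ik}(\vec v,\vec w)\}$ if $j=i$ and $\emptyset$ otherwise; $G_{ik}(j,k',\vec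 v,\vec w)=\{X_{a_{ik1}}(\vec f_{ik1}(\vec v,\vec w)),\dots,X_{a_{ikp_{ik}}}(\vec f_{ikp_{ik}}(\vec v,\vec w))\}$ if $j=i,k'=k$ and $\emptyset$ otherwise. An equivalence $\sim$ on $A$ extends to subsets by $\alpha\sim\beta$ iff $\{[a]_\sim\mid a\in\alpha\}=\{[b]_\sim\mid b\in\beta\}$. A pair $\langle\sim_D,\sim_B\rangle$ of equivalences on $\mathrm{sig}(\mathcal{E})$ and $B$ is feasible if: (1) $i\ne j$ implies $X_i(\vec v)\not\sim_D X_j(\vec v')$; (2) $X_i(\vec v)\sim_D X_i(\vec v')$ implies $F_{ik}(X_i(\vec v))\sim_B F_{ik}(X_i(\vec v'))$ for all $k$; (3) $i\ne j$ or $k\ne k'$ implies $(i,k,\vec v,\vec w)\not\sim_B(j,k',\vec v',\vec w')$; (4) $(i,k,\vec v,\vec w)\sim_B(i,k,\vec v',\vec w')$ implies $G_{ik}(i,k,\vec v,\vec w)\sim_D G_{ik}(i,k,\vec v',\vec w')$. A partition family is a tuple $\mathcal{P}=\langle\Phi_1,\dots,\Phi_n,\Psi_{11},\dots,\Psi_{nm_n}\rangle$ where $\Phi_i$ is a partition of $\mathbb{D}_i$ and $\Psi_{ik}$ a partition of $\mathbb{D}_i\times\mathbb{E}_{ik}$ (a partition of $A$ being a family of pairwise disjoint sets with union $A$). It induces $\sim^D_{\mathcal{P}}$ on $\mathrm{sig}(\mathcal{E})$: $X_i(\vec v)\sim^D_{\mathcal{P}}X_j(\vec v')$ iff $i=j$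 and $\vec v,\vec v'$ lie in the same block of $\Phi_i$; and $\sim^B_{\mathcal{P}}$ on $B$: $(i,k,\vec v,\vec w)\sim^B_{\mathcal{P}}(j,k',\vec v',\vec w')$ iff $i=j$, $k=k'$ and $(\vec v,\vec w),(\vec v',\vec w')$ lie in the same block of $\Psi_{ik}$. For $\psi\subseteq\mathbb{D}_i\times\mathbb{E}_{ik}$ let $F'_{ik}(\psi)=\{\vec v\mid \exists\vec w.\ (i,k,\vec v,\vec w)\in F_{ik}(X_i(\vec v)),(\vec v,\vec w)\in\psi\}$; for $\phi\subseteq\mathrm{sig}(\mathcal{E})$ let $G'_{ik}(\phi)=\{(\vec v,\vec w)\mid G_{ik}(i,k,\vec v,\vec w)\cap\phi\neq\emptyset\}$. Define $\Phi\otimes^D_{ik}\psi=\{F'_{ik}(\psi)\cap\phi\mid\phi\in\Phi\}\cup\{\overline{F'_{ik}(\psi)}\cap\phi\mid\phi\in\Phi\}$ and $\Psi\otimes^B_{ik}\phi=\{G'_{ik}(\phi)\cap\psi\mid\psi\in\Psi\}\cup\{\overline{G'_{ik}(\phi)}\cap\psi\mid\psi\in\Psi\}$ (overline = complement), extended to finite or arbitrary sets of arguments by successive application (order-independent): $\Phi\otimes\{\psi_1,\dots\}=\Phi\otimes\psi_1\otimes\cdots$. Let $H^D_{ik}(\mathcal{P})$ replace $\Phi_i$ by $\Phi_i\otimes^D_{ik}\Psi_{ik}$, and $H^B_{ik}(\mathcal{P})$ replace $\Psi_{ik}$ by $\Psi_{ik}\otimes^B_{ik}\Delta_D$ where $\Delta_D=\bigcup_{1\le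 j\le p_{ik}}\{\{X_{a_{ikj}}(\vec v)\mid\vec v\in\phi\}\mid\phi\in\Phi_{a_{ikj}}\}$, all other components unchanged. Set $H^D=H^D_{nm_n}\circ\cdots\circ H^D_{11}$, $H^B=H^B_{nm_n}\circ\cdots\circ H^B_{11}$, $H=H^B\circ H^D$, and $\mathcal{P}_0=\langle\{\mathbb{D}_1\},\dots,\{\mathbb{D}_n\},\{\mathbb{D}_1\times\mathbb{E}_{11}\},\dots,\{\mathbb{D}_n\times\mathbb{E}_{nm_n}\}\rangle$. -}

module Defs where

open import Level using (0ℓ)
open import Data.Nat using (ℕ; zero; suc)
open import Data.Fin using (Fin; _≟_)
open import Data.Bool using (Bool; true; false; if_then_else_; T)
open import Data.Unit using (⊤; tt)
open import Data.Product using (Σ; ∃; _×_; _,_; proj₁; proj₂)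
open import Data.List using (List; foldl; concatMap; map; allFin)
open import Relation.Nullary using (¬_; yes; no)
open import Relation.Unary using (Pred; _≐_)
open import Relation.Binary using (Rel; IsEquivalence)
open import Relation.Binary.PropositionalEquality using (_≡_; _≢_; refl)

data Fixpoint : Set where
  μ ν : Fixpoint

-- Two families are identified when they have the same blocks as sets
-- (extensional equality of subsets), i.e. we compare the *sets* of blocks.
record Family (A : Set) : Set₁ where
  field
    Idx : Set
    blk : Idx → Pred A 0ℓ
open Family public

_≋_ : ∀ {A} → Family A → Family A → Set
P ≋ Q = (∀ i → ∃ λ j → blk P i ≐ blk Q j) × (∀ j → ∃ λ i → blk Q j ≐ blk P i)

Class : ∀ {A : Set} → Rel A 0ℓ → A → Pred A 0ℓ
Class _~_ a x = x ~ a

SetEqUpTo : ∀ {A : Set} → Rel A 0ℓ → Pred A 0ℓ → Pred A 0ℓ → Set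
SetEqUpTo {A} _~_ α β =
  (∀ a → α a → Σ A λ b → β b × (Class _~_ a ≐ Class _~_ b)) ×
  (∀ b → β b → Σ A λ a → α a × (Class _~_ b ≐ Class _~_ a))

-- Same j j' says that the arguments
-- indexed by j and j' are the same set (so the choice c must agree on
-- them; arguments form a *set*).
splitBy : ∀ {A : Set} → Family A → (J : Set) → (J → Pred A 0ℓ) →
          (J → J → Set) → Family A
splitBy Φ J S Same = record
  { Idx = Σ (Idx Φ × (J → Bool)) λ ic →
            ∀ j j' → Same j j' → proj₂ ic j ≡ proj₂ ic j'
  ; blk = λ { ((i , c) , _) x →
              blk Φ i x × (∀ j → (if c j then S j x else ¬ S j x)) }
  }

refine : ∀ {A C : Set} → Family A → Family C → (Pred C 0ℓ → Pred A 0ℓ) →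
         Family A
refine Φ Ψ T = splitBy Φ (Idx Ψ) (λ j → T (blk Ψ j))
                 (λ j j' → blk Ψ j ≐ blk Ψ j')

record PBES : Set₁ where
  field
    n   : ℕ
    σ   : Fin n → Fixpoint
    D   : Fin n → Set
    m   : Fin n → ℕ
    E   : (i : Fin n) → Fin (m i) → Set
    φ   : (i : Fin n) (k : Fin (m i)) → D i → E i k → Bool
    p   : (i : Fin n) → Fin (m i) → ℕ
    a   : (i : Fin n) (k : Fin (m i)) → Fin (p i k) → Fin n
    f   : (i : Fin n) (k : Fin (m i)) (j : Fin (p i k)) →
          D i → E i k → D (a i k j)

module _ (𝓔 : PBES) where
  open PBES 𝓔

  Sig : Set
  Sig = Σ (Fin n) D

  B : Set
  B = Σ (Fin n) λ i → Σ (Fin (m i)) λ k → D i × E i k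

  IK : Set
  IK = Σ (Fin n) λ i → Fin (m i)

  data F (i : Fin n) (k : Fin (m i)) : Sig → Pred B 0ℓ where
    inF : ∀ {v w} → T (φ i k v w) → F i k (i , v) (i , k , v , w)

  data G (i : Fin n) (k : Fin (m i)) : B → Pred Sig 0ℓ where
    inG : ∀ {v w} (l : Fin (p i k)) →
          G i k (i , k , v , w) (a i k l , f i k l v w)

  F′ : (i : Fin n) (k : Fin (m i)) → Pred (D i × E i k) 0ℓ → Pred (D i) 0ℓ
  F′ i k ψ v = ∃ λ w → F i k (i , v) (i , k , v , w) × ψ (v , w)

  G′ : (i : Fin n) (k : Fin (m i)) → Pred Sig 0ℓ → Pred (D i × E i k) 0ℓ
  G′ i k ϕ (v , w) = ∃ λ x → G i k (i , k , v , w) x × ϕ x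

  record PartitionFamily : Set₁ where
    field
      Φ : (i : Fin n) → Family (D i)
      Ψ : (i : Fin n) (k : Fin (m i)) → Family (D i × E i k)
  open PartitionFamily public

  _≈PF_ : PartitionFamily → PartitionFamily → Set
  P ≈PF Q = (∀ i → Φ P i ≋ Φ Q i) × (∀ i k → Ψ P i k ≋ Ψ Q i k)

  data SameD (P : PartitionFamily) : Sig → Sig → Set where
    sameD : ∀ {i v v'} (b : Idx (Φ P i)) →
            blk (Φ P i) b v → blk (Φ P i) b v' → SameD P (i , v) (i , v')

  data SameB (P : PartitionFamily) : B → B → Set where
    sameB : ∀ {i k v w v' w'} (b : Idx (Ψ P i k)) →
            blk (Ψ P i k) b (v , w) → blk (Ψ P i k) b (v' , w') →
            SameB P (i , k , v , w) (i , k , v' , w')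

  ∼D : PartitionFamily → Rel Sig 0ℓ
  ∼D P = SameD P

  ∼B : PartitionFamily → Rel B 0ℓ
  ∼B P = SameB P

  record Feasible (_~D_ : Rel Sig 0ℓ) (_~B_ : Rel B 0ℓ) : Set where
    field
      isEquivD : IsEquivalence _~D_
      isEquivB : IsEquivalence _~B_
      cond1 : ∀ {i j v v'} → i ≢ j → ¬ ((i , v) ~D (j , v'))
      cond2 : ∀ {i v v'} → (i , v) ~D (i , v') →
              ∀ k → SetEqUpTo _~B_ (F i k (i , v)) (F i k (i , v'))
      cond3 : ∀ {i j k k' v w v' w'} →
              _≢_ {A = IK} (i , k) (j , k') →
              ¬ ((i , k , v , w) ~B (j , k' , v' , w'))
      cond4 : ∀ {i k v w v' w'} → (i , k , v , w) ~B (i , k , v' , w') →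
              SetEqUpTo _~D_ (G i k (i , k , v , w)) (G i k (i , k , v' , w'))

  updΦ : (i : Fin n) → Family (D i) → ((j : Fin n) → Family (D j)) →
         (j : Fin n) → Family (D j)
  updΦ i new old j with j ≟ i
  ... | yes refl = new
  ... | no _     = old j

  updΨ : (i : Fin n) (k : Fin (m i)) → Family (D i × E i k) →
         ((j : Fin n) (k' : Fin (m j)) → Family (D j × E j k')) →
         (j : Fin n) (k' : Fin (m j)) → Family (D j × E j k')
  updΨ i k new old j k' with j ≟ i
  ... | no _ = old j k'
  ... | yes refl with k' ≟ k
  ...   | yes refl = new
  ...   | no _     = old j k'

  HD : (i : Fin n) (k : Fin (m i)) → PartitionFamily → PartitionFamily
  HD i k P = record
    { Φ = updΦ i (refine (Φ P i) (Ψ P i k) (F′ i k)) (Φ P)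
    ; Ψ = Ψ P }

  data InΔ (P : PartitionFamily) (i : Fin n) (k : Fin (m i))
           (j : Fin (p i k)) (b : Idx (Φ P (a i k j))) : Pred Sig 0ℓ where
    inΔ : ∀ {v} → blk (Φ P (a i k j)) b v → InΔ P i k j b (a i k j , v)

  ΔD : PartitionFamily → (i : Fin n) (k : Fin (m i)) → Family Sig
  ΔD P i k = record
    { Idx = Σ (Fin (p i k)) λ j → Idx (Φ P (a i k j))
    ; blk = λ { (j , b) → InΔ P i k j b } }

  HB : (i : Fin n) (k : Fin (m i)) → PartitionFamily → PartitionFamily
  HB i k P = record
    { Φ = Φ P
    ; Ψ = updΨ i k (refine (Ψ P i k) (ΔD P i k) (G′ i k)) (Ψ P) }

  pairs : List IK
  pairs = concatMap (λ i → map (i ,_) (allFin (m i))) (allFin n)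

  HᴰAll : PartitionFamily → PartitionFamily
  HᴰAll P = foldl (λ Q ik → HD (proj₁ ik) (proj₂ ik) Q) P pairs

  HᴮAll : PartitionFamily → PartitionFamily
  HᴮAll P = foldl (λ Q ik → HB (proj₁ ik) (proj₂ ik) Q) P pairs

  H : PartitionFamily → PartitionFamily
  H P = HᴮAll (HᴰAll P)

  H^ : ℕ → PartitionFamily → PartitionFamily
  H^ zero    P = P
  H^ (suc r) P = H (H^ r P)

  P₀ : PartitionFamily
  P₀ = record
    { Φ = λ i → record { Idx = ⊤ ; blk = λ _ _ → ⊤ }
    ; Ψ = λ i k → record { Idx = ⊤ ; blk = λ _ _ → ⊤ } }

-- Every application of H only splits blocks, and, using excluded middle to
-- decide membership in the splitting sets, it turns partitions into
-- partitions; so all iterates of P₀ are partition families and their induced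
-- relations are equivalences with Conditions 1 and 3 built in.  At a fixed
-- point the splitting by H is vacuous up to equality of block sets: two
-- parameters in one block of Φᵢ reach exactly the same blocks of every Ψᵢₖ
-- through F′ᵢₖ, and two pairs in one block of Ψᵢₖ reach exactly the same
-- blocks of Δ_D through G′ᵢₖ.  Covering the targets by blocks turns these two
-- stability properties into Conditions 2 and 4.
module Submission where

open import Defs
open import Level using (Level; 0ℓ)
open import Data.Nat using (ℕ; suc; zero)
open import Axiom.ExcludedMiddle using (ExcludedMiddle)
open import Data.Fin using (Fin; _≟_)
open import Data.Bool using (Bool; true; if_then_else_)
open import Data.Unit using (⊤; tt)
open import Data.Empty using (⊥-elim)
open import Function using (id)
open import Data.Product using (∃; _×_; _,_; proj₁; proj₂; swap)
open import Data.List using ([]; _∷_; foldl; map; allFin)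
import Data.List.Relation.Unary.Any as Any
open import Data.List.Relation.Unary.Any using (here; there)
open import Data.List.Membership.Propositional using (_∈_)
open import Data.List.Membership.Propositional.Properties
  using (∈-concatMap⁺; ∈-map⁺; ∈-allFin)
open import Relation.Nullary using (¬_; yes; no; does; proof; map′)
open import Relation.Nullary.Reflects using (of; invert; det)
open import Relation.Unary using (Pred; _⊆_; _≐_)
open import Relation.Binary using (Rel; IsEquivalence)
open import Relation.Binary.PropositionalEquality
  using (_≡_; _≢_; refl; sym; cong; subst)

private
  variable
    ℓ₁ ℓ₂ ℓ : Level
    A C J : Set

if-det : ∀ {P : Set} c c′ →
         (if c then P else ¬ P) → (if c′ then P else ¬ P) → c ≡ c′
if-det c c′ p q = det (of {b = c} p) (of {b = c′} q)

SameBlock : Family A → Rel A 0ℓ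
SameBlock Φ x y = ∃ λ b → blk Φ b x × blk Φ b y

-- Block indices are not unique, so disjointness is phrased as: two blocks
-- that overlap have the same elements.
record IsPartition (Φ : Family A) : Set where
  field
    cover     : ∀ x → ∃ λ b → blk Φ b x
    overlap-⊆ : ∀ {b b′ x} → blk Φ b x → blk Φ b′ x → blk Φ b ⊆ blk Φ b′
open IsPartition

≋-refl : {Φ : Family A} → Φ ≋ Φ
≋-refl = (λ b → b , id , id) , (λ b → b , id , id)

sameBlock-≋ : {Φ Φ′ : Family A} → Φ ≋ Φ′ → ∀ {x y} →
              SameBlock Φ x y → SameBlock Φ′ x y
sameBlock-≋ Φ≋Φ′ (b , bx , by) =
  let b′ , b⊆b′ , _ = proj₁ Φ≋Φ′ b in b′ , b⊆b′ bx , b⊆b′ by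

trivial-isPartition : IsPartition {A} (record { Idx = ⊤ ; blk = λ _ _ → ⊤ })
trivial-isPartition = record { cover = λ _ → tt , tt ; overlap-⊆ = λ _ _ _ → tt }

-- One half of the condition under which refining Φ by Ψ through T keeps x and
-- y in one block.
Unsplit : Family C → (Pred C 0ℓ → Pred A 0ℓ) → Rel A 0ℓ
Unsplit Ψ T x y = ∀ j → T (blk Ψ j) x → T (blk Ψ j) y

Monotone : (Pred C 0ℓ → Pred A 0ℓ) → Set₁
Monotone T = ∀ {X Y} → X ⊆ Y → T X ⊆ T Y

unsplit-≋ : {Ψ Ψ′ : Family C} {T : Pred C 0ℓ → Pred A 0ℓ} → Monotone T →
              Ψ ≋ Ψ′ → ∀ {x y} → Unsplit Ψ T x y → Unsplit Ψ′ T x y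
unsplit-≋ T-mono Ψ≋Ψ′ sep j′ Tx =
  let j , j′⊆j , j⊆j′ = proj₂ Ψ≋Ψ′ j′ in T-mono j⊆j′ (sep j (T-mono j′⊆j Tx))

splitBy-isPartition : ExcludedMiddle 0ℓ → {Φ : Family A} {J : Set}
  {S : J → Pred A 0ℓ} {Same : J → J → Set} →
  (∀ j j′ → Same j j′ → S j ≐ S j′) →
  IsPartition Φ → IsPartition (splitBy Φ J S Same)
splitBy-isPartition em {Φ} {J} {S} {Same} S-resp pΦ = record
  { cover     = splitCover
  ; overlap-⊆ = λ { {(b , c) , _} {(b′ , c′) , _} (bx , cx) (b′x , c′x) (by , cy) →
      overlap-⊆ pΦ bx b′x by ,
      λ j → subst (λ β → if β then S j _ else ¬ S j _)
                  (if-det (c j) (c′ j) (cx j) (c′x j)) (cy j) }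
  }
  where
  splitCover : ∀ x → ∃ λ β → blk (splitBy Φ J S Same) β x
  splitCover x =
    ((proj₁ (cover pΦ x) , verdict) , coherent) ,
    proj₂ (cover pΦ x) , λ j → invert (proof (em {S j x}))
    where
    verdict : J → Bool
    verdict j = does (em {S j x})
    coherent : ∀ j j′ → Same j j′ → verdict j ≡ verdict j′
    coherent j j′ s = det (proof (em {S j x}))
      (proof (map′ (proj₂ (S-resp j j′ s)) (proj₁ (S-resp j j′ s)) (em {S j′ x})))

splitBy-sameBlock : {Φ : Family A} {S : J → Pred A 0ℓ} {Same : J → J → Set} →
  ∀ {x y} → SameBlock (splitBy Φ J S Same) x y →
  SameBlock Φ x y × (∀ j → S j x → S j y)
splitBy-sameBlock {S = S} {y = y} (((b , c) , _) , (bx , cx) , (by , cy)) =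
  (b , bx , by) ,
  λ j Sx → subst (λ β → if β then S j y else ¬ S j y)
                 (if-det (c j) true (cx j) Sx) (cy j)

refine-isPartition : ExcludedMiddle 0ℓ → {Φ : Family A} {Ψ : Family C}
  {T : Pred C 0ℓ → Pred A 0ℓ} → Monotone T →
  IsPartition Φ → IsPartition (refine Φ Ψ T)
refine-isPartition em T-mono =
  splitBy-isPartition em λ _ _ (j⊆j′ , j′⊆j) → T-mono j⊆j′ , T-mono j′⊆j

refine-sameBlock : {Φ : Family A} {Ψ : Family C} {T : Pred C 0ℓ → Pred A 0ℓ} →
  ∀ {x y} → SameBlock (refine Φ Ψ T) x y → SameBlock Φ x y × Unsplit Ψ T x y
refine-sameBlock {Ψ = Ψ} {T} = splitBy-sameBlock {S = λ j → T (blk Ψ j)}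

Class-≐ : {_~_ : Rel A 0ℓ} → IsEquivalence _~_ →
          ∀ {x y} → x ~ y → Class _~_ x ≐ Class _~_ y
Class-≐ e x~y = (λ z~x → E.trans z~x x~y) , (λ z~y → E.trans z~y (E.sym x~y))
  where module E = IsEquivalence e

simulation⇒SetEqUpTo : {_~_ : Rel A 0ℓ} → IsEquivalence _~_ →
  {α β : Pred A 0ℓ} →
  (∀ x → α x → ∃ λ y → β y × x ~ y) → (∀ y → β y → ∃ λ x → α x × y ~ x) →
  SetEqUpTo _~_ α β
simulation⇒SetEqUpTo e α≲β β≲α =
  (λ x αx → let y , βy , x~y = α≲β x αx in y , βy , Class-≐ e x~y) ,
  (λ y βy → let x , αx , y~x = β≲α y βy in x , αx , Class-≐ e y~x)

foldl-preserves : {S : Set ℓ₁} {X : Set ℓ₂} (f : S → X → S) (P : S → Set ℓ) →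
  (∀ {s x} → P s → P (f s x)) → ∀ {s} xs → P s → P (foldl f s xs)
foldl-preserves f P step []       Ps = Ps
foldl-preserves f P step (x ∷ xs) Ps = foldl-preserves f P step xs (step Ps)

foldl-reflects : {S : Set ℓ₁} {X : Set ℓ₂} (f : S → X → S) (R : S → Set ℓ)
  (Good : S → X → Set ℓ) →
  (∀ {s x} → R (f s x) → R s × Good s x) →
  (∀ {s x y} → Good (f s x) y → Good s y) →
  ∀ {s} xs → R (foldl f s xs) → R s × (∀ {x} → x ∈ xs → Good s x)
foldl-reflects f R Good step back []       Rs = Rs , λ ()
foldl-reflects f R Good step back (x ∷ xs) Rs =
  let R₁ , good = foldl-reflects f R Good step back xs Rs
      R₀ , goodx = step R₁
  in R₀ , λ { (here refl) → goodx ; (there x∈xs) → back (good x∈xs) }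

module _ (𝓔 : PBES) where
  open PBES 𝓔

  F′-monotone : ∀ i k → Monotone (F′ 𝓔 i k)
  F′-monotone i k X⊆Y (w , Fw , Xw) = w , Fw , X⊆Y Xw

  G′-monotone : ∀ i k → Monotone (G′ 𝓔 i k)
  G′-monotone i k X⊆Y (x , Gx , Xx) = x , Gx , X⊆Y Xx

  updΦ-elim : ∀ {i new old} (Pr : (j : Fin n) → Family (D j) → Set) →
    Pr i new → (∀ j → j ≢ i → Pr j (old j)) → ∀ j → Pr j (updΦ 𝓔 i new old j)
  updΦ-elim {i} Pr Pnew Pold j with j ≟ i
  ... | yes refl = Pnew
  ... | no j≢i   = Pold j j≢i

  updΨ-elim : ∀ {i k new old}
    (Pr : (j : Fin n) (k′ : Fin (m j)) → Family (D j × E j k′) → Set) →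
    Pr i k new → (∀ j k′ → _≢_ {A = IK 𝓔} (j , k′) (i , k) → Pr j k′ (old j k′)) →
    ∀ j k′ → Pr j k′ (updΨ 𝓔 i k new old j k′)
  updΨ-elim {i} {k} Pr Pnew Pold j k′ with j ≟ i
  ... | no j≢i = Pold j k′ λ eq → j≢i (cong proj₁ eq)
  ... | yes refl with k′ ≟ k
  ...   | yes refl = Pnew
  ...   | no k′≢k  = Pold j k′ λ { refl → k′≢k refl }

  ∈-pairs : ∀ i k → (i , k) ∈ pairs 𝓔
  ∈-pairs i k = ∈-concatMap⁺ (λ j → map (j ,_) (allFin (m j)))
    (Any.map (λ { refl → ∈-map⁺ (i ,_) (∈-allFin k) }) (∈-allFin i))

  IsPartitionFamily : PartitionFamily 𝓔 → Set
  IsPartitionFamily P = (∀ i → IsPartition (Φ P i)) × (∀ i k → IsPartition (Ψ P i k))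

  HD-isPartition : ExcludedMiddle 0ℓ → ∀ {i k P} →
    IsPartitionFamily P → IsPartitionFamily (HD 𝓔 i k P)
  HD-isPartition em {i} {k} (pΦ , pΨ) =
    updΦ-elim (λ _ → IsPartition) (refine-isPartition em (F′-monotone i k) (pΦ i))
              (λ j _ → pΦ j) ,
    pΨ

  HB-isPartition : ExcludedMiddle 0ℓ → ∀ {i k P} →
    IsPartitionFamily P → IsPartitionFamily (HB 𝓔 i k P)
  HB-isPartition em {i} {k} (pΦ , pΨ) =
    pΦ ,
    updΨ-elim (λ _ _ → IsPartition)
              (refine-isPartition em (G′-monotone i k) (pΨ i k))
              (λ j k′ _ → pΨ j k′)

  H^-isPartition : ExcludedMiddle 0ℓ → ∀ r → IsPartitionFamily (H^ 𝓔 r (P₀ 𝓔))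
  H^-isPartition em zero    = (λ _ → trivial-isPartition) , (λ _ _ → trivial-isPartition)
  H^-isPartition em (suc r) =
    foldl-preserves _ IsPartitionFamily (HB-isPartition em) (pairs 𝓔)
      (foldl-preserves _ IsPartitionFamily (HD-isPartition em) (pairs 𝓔)
        (H^-isPartition em r))

  HD-sameBlock : ∀ {i₀ k₀} P i {v v′} → SameBlock (Φ (HD 𝓔 i₀ k₀ P) i) v v′ →
    SameBlock (Φ P i) v v′ ×
    (∀ {k} → _≡_ {A = IK 𝓔} (i₀ , k₀) (i , k) → Unsplit (Ψ P i k) (F′ 𝓔 i k) v v′)
  HD-sameBlock {i₀} {k₀} P = updΦ-elim Pr
    (λ sb → let sb₀ , sep = refine-sameBlock {Φ = Φ P i₀} {Ψ P i₀ k₀} {F′ 𝓔 i₀ k₀} sb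
            in sb₀ , λ { refl → sep })
    (λ j j≢i₀ sb → sb , λ eq → ⊥-elim (j≢i₀ (sym (cong proj₁ eq))))
    where
    Pr : (j : Fin n) → Family (D j) → Set
    Pr j X = ∀ {v v′} → SameBlock X v v′ → SameBlock (Φ P j) v v′ ×
      (∀ {k} → _≡_ {A = IK 𝓔} (i₀ , k₀) (j , k) → Unsplit (Ψ P j k) (F′ 𝓔 j k) v v′)

  ΔD-≋ : ∀ {P Q} → (∀ i → Φ P i ≋ Φ Q i) → ∀ i k → ΔD 𝓔 P i k ≋ ΔD 𝓔 Q i k
  ΔD-≋ Φ≋ i k = blocksOf Φ≋ , λ β → blocksOf (λ j → swap (Φ≋ j)) β
    where
    InΔ-⊆ : ∀ {P Q l b b′} → blk (Φ P (a i k l)) b ⊆ blk (Φ Q (a i k l)) b′ →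
            InΔ 𝓔 P i k l b ⊆ InΔ 𝓔 Q i k l b′
    InΔ-⊆ b⊆b′ (inΔ bv) = inΔ (b⊆b′ bv)
    blocksOf : ∀ {P Q} → (∀ i → Φ P i ≋ Φ Q i) →
               ∀ β → ∃ λ β′ → blk (ΔD 𝓔 P i k) β ≐ blk (ΔD 𝓔 Q i k) β′
    blocksOf Φ≋ (l , b) =
      let b′ , b⊆b′ , b′⊆b = proj₁ (Φ≋ (a i k l)) b
      in (l , b′) , InΔ-⊆ b⊆b′ , InΔ-⊆ b′⊆b

  HB-sameBlock : ∀ {i₀ k₀} P i k {x y} → SameBlock (Ψ (HB 𝓔 i₀ k₀ P) i k) x y →
    SameBlock (Ψ P i k) x y ×
    (_≡_ {A = IK 𝓔} (i₀ , k₀) (i , k) → Unsplit (ΔD 𝓔 P i k) (G′ 𝓔 i k) x y)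
  HB-sameBlock {i₀} {k₀} P = updΨ-elim Pr
    (λ sb → let sb₀ , sep = refine-sameBlock {Φ = Ψ P i₀ k₀} {ΔD 𝓔 P i₀ k₀} {G′ 𝓔 i₀ k₀} sb
            in sb₀ , λ { refl → sep })
    (λ j k′ ne sb → sb , λ eq → ⊥-elim (ne (sym eq)))
    where
    Pr : (j : Fin n) (k : Fin (m j)) → Family (D j × E j k) → Set
    Pr j k X = ∀ {x y} → SameBlock X x y → SameBlock (Ψ P j k) x y ×
      (_≡_ {A = IK 𝓔} (i₀ , k₀) (j , k) → Unsplit (ΔD 𝓔 P j k) (G′ 𝓔 j k) x y)

  HᴰAll-sameBlock : ∀ P i {v v′} → SameBlock (Φ (HᴰAll 𝓔 P) i) v v′ →
                    ∀ k → Unsplit (Ψ P i k) (F′ 𝓔 i k) v v′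
  HᴰAll-sameBlock P i {v} {v′} sb k =
    proj₂ (foldl-reflects _ (λ Q → SameBlock (Φ Q i) v v′)
             (λ Q ik → ∀ {k} → ik ≡ (i , k) → Unsplit (Ψ Q i k) (F′ 𝓔 i k) v v′)
             (λ {Q} → HD-sameBlock Q i) (λ good → good) (pairs 𝓔) sb)
          (∈-pairs i k) refl

  HᴮAll-sameBlock : ∀ P i k {x y} → SameBlock (Ψ (HᴮAll 𝓔 P) i k) x y →
                    Unsplit (ΔD 𝓔 P i k) (G′ 𝓔 i k) x y
  HᴮAll-sameBlock P i k {x} {y} sb =
    proj₂ (foldl-reflects _ (λ Q → SameBlock (Ψ Q i k) x y)
             (λ Q ik → ik ≡ (i , k) → Unsplit (ΔD 𝓔 Q i k) (G′ 𝓔 i k) x y)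
             (λ {Q} → HB-sameBlock Q i k)
             (λ good eq → unsplit-≋ (G′-monotone i k)
                            (ΔD-≋ (λ _ → ≋-refl) i k) (good eq))
             (pairs 𝓔) sb)
          (∈-pairs i k) refl

  Φ-HᴮAll : ∀ P → Φ (HᴮAll 𝓔 P) ≡ Φ P
  Φ-HᴮAll P = foldl-preserves _ (λ Q → Φ Q ≡ Φ P) (λ eq → eq) (pairs 𝓔) refl

  record Stable (P : PartitionFamily 𝓔) : Set where
    field
      Φ-stable : ∀ {i v v′} → SameBlock (Φ P i) v v′ →
                 ∀ k → Unsplit (Ψ P i k) (F′ 𝓔 i k) v v′
      Ψ-stable : ∀ {i k x y} → SameBlock (Ψ P i k) x y →
                 Unsplit (ΔD 𝓔 P i k) (G′ 𝓔 i k) x y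
  open Stable

  H-fixedPoint⇒stable : ∀ P → _≈PF_ 𝓔 (H 𝓔 P) P → Stable P
  H-fixedPoint⇒stable P (HΦ≋Φ , HΨ≋Ψ) = record
    { Φ-stable = λ {i} sb → HᴰAll-sameBlock P i (sameBlock-≋ (swap (HᴰΦ≋Φ i)) sb)
    ; Ψ-stable = λ {i} {k} sb →
        unsplit-≋ (G′-monotone i k) (ΔD-≋ HᴰΦ≋Φ i k)
          (HᴮAll-sameBlock (HᴰAll 𝓔 P) i k (sameBlock-≋ (swap (HΨ≋Ψ i k)) sb))
    }
    where
    HᴰΦ≋Φ : ∀ i → Φ (HᴰAll 𝓔 P) i ≋ Φ P i
    HᴰΦ≋Φ i = subst (λ Φs → Φs i ≋ Φ P i) (Φ-HᴮAll (HᴰAll 𝓔 P)) (HΦ≋Φ i)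

  module _ {P : PartitionFamily 𝓔} (pP : IsPartitionFamily P) where

    ∼D-isEquivalence : IsEquivalence (∼D 𝓔 P)
    ∼D-isEquivalence = record
      { refl  = λ { {i , v} → let b , bv = cover (proj₁ pP i) v in sameD b bv bv }
      ; sym   = λ { (sameD b bv bv′) → sameD b bv′ bv }
      ; trans = λ { (sameD {i} b bu bv) (sameD b′ b′v b′w) →
                      sameD b′ (overlap-⊆ (proj₁ pP i) bv b′v bu) b′w }
      }

    ∼B-isEquivalence : IsEquivalence (∼B 𝓔 P)
    ∼B-isEquivalence = record
      { refl  = λ { {i , k , x} → let b , bx = cover (proj₂ pP i k) x in sameB b bx bx }
      ; sym   = λ { (sameB b bx by) → sameB b by bx }
      ; trans = λ { (sameB {i} {k} b bx by) (sameB b′ b′y b′z) →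
                      sameB b′ (overlap-⊆ (proj₂ pP i k) by b′y bx) b′z }
      }

    F-simulation : Stable P → ∀ {i v v′} → SameBlock (Φ P i) v v′ → ∀ k β →
      F 𝓔 i k (i , v) β → ∃ λ β′ → F 𝓔 i k (i , v′) β′ × ∼B 𝓔 P β β′
    F-simulation st {i} {v} sb k _ (inF {w = w} φvw)
      with j , jvw ← cover (proj₂ pP i k) (v , w)
      with _ , inF φv′w′ , jv′w′ ← Φ-stable st sb k j (w , inF φvw , jvw)
      = _ , inF φv′w′ , sameB j jvw jv′w′

    G-simulation : Stable P → ∀ {i k v w v′ w′} → SameBlock (Ψ P i k) (v , w) (v′ , w′) →
      ∀ u → G 𝓔 i k (i , k , v , w) u →
      ∃ λ u′ → G 𝓔 i k (i , k , v′ , w′) u′ × ∼D 𝓔 P u u′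
    G-simulation st {i} {k} {v} {w} sb _ (inG l)
      with b , bu ← cover (proj₁ pP (a i k l)) (f i k l v w)
      with _ , Gu′ , inΔ bu′ ← Ψ-stable st sb (l , b) (_ , inG l , inΔ bu)
      = _ , Gu′ , sameD b bu bu′

    stable⇒feasible : Stable P → Feasible 𝓔 (∼D 𝓔 P) (∼B 𝓔 P)
    stable⇒feasible st = record
      { isEquivD = ∼D-isEquivalence
      ; isEquivB = ∼B-isEquivalence
      ; cond1 = λ { i≢j (sameD _ _ _) → i≢j refl }
      ; cond2 = λ { (sameD b bv bv′) k → simulation⇒SetEqUpTo ∼B-isEquivalence
                      (F-simulation st (b , bv , bv′) k) (F-simulation st (b , bv′ , bv) k) }
      ; cond3 = λ { ik≢jk′ (sameB _ _ _) → ik≢jk′ refl }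
      ; cond4 = λ { (sameB b bx by) → simulation⇒SetEqUpTo ∼D-isEquivalence
                      (G-simulation st (b , bx , by)) (G-simulation st (b , by , bx)) }
      }

theorem3 : ExcludedMiddle 0ℓ → (𝓔 : PBES) → (m : ℕ) →
    _≈PF_ 𝓔 (H^ 𝓔 (suc m) (P₀ 𝓔)) (H^ 𝓔 m (P₀ 𝓔)) →
    Feasible 𝓔 (∼D 𝓔 (H^ 𝓔 m (P₀ 𝓔))) (∼B 𝓔 (H^ 𝓔 m (P₀ 𝓔)))
theorem3 em 𝓔 m fixedPoint =
  stable⇒feasible 𝓔 (H^-isPartition 𝓔 em m)
    (H-fixedPoint⇒stable 𝓔 (H^ 𝓔 m (P₀ 𝓔)) fixedPoint)
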